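{- Let $(\sigma_0,\sigma_1,\dots,\sigma_t)$ be a sequence of swaps and let $o_a,o_b$ be objects with $1\le a<b\le n$. Let $a'=\sigma_t^T(o_a)$, $b'=\sigma_t^T(o_b)$ and $Q=[a,a']\cap[b,b']$, and assume $Q\neq\emptyset$. (a) If $a'>a$ and $b'>b$, then $o_a\succ_q o_b$ for all $q\in Q$. (b) If $a'<a$ and $b'<b$, then $o_b\succ_q o_a$ for all $q\in Q$.
   Context: Agents $N=\{1,\dots,n\}$ lie on a path in this order (edges between $i$ and $i+1$); objects $O=\{o_1,\dots,o_n\}$; each agent $i$ has a strict preference $\succ_i$ (a linear order on $O$); the initial assignment is $\sigma_0(i)=o_i$. A swap exchanges the objects of two adjacent agents in an assignment $\sigma$ and is allowed only if both strictly prefer the object they receive. A sequence of swaps $(\sigma_0,\dots,\sigma_t)$ starts at the initial assignment and each $\sigma_r$ arises from $\sigma_{r-1}$ by an allowed swap. $\sigma^T(o)$ denotes the agent holding $o$ in $\sigma$. For integers $x,y$, $[x,y]$ denotes the set of integers between $x$ and $y$ inclusive, regardless of whether $x\le y$ (so $[x,y]=[y,x]$). -}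

module Defs where

open import Data.Nat using (ℕ; suc; _≤_; _⊓_; _⊔_)
open import Data.Fin using (Fin; toℕ)
open import Data.Product using (_×_)
open import Relation.Binary.PropositionalEquality using (_≡_)
open import Relation.Binary.Structures using (IsStrictTotalOrder)
open import Relation.Nullary using (¬_)

-- Agents and objects are both indexed by Fin n; agent i (0-based) is the
-- i-th vertex of the path, object o_i is the index i.

record Profile (n : ℕ) : Set₁ where
  field
    _≻[_]_   : Fin n → Fin n → Fin n → Set
    isStrict : ∀ i → IsStrictTotalOrder _≡_ (λ x y → x ≻[ i ] y)
open Profile public

-- An assignment maps each agent to the object it holds.
Assignment : ℕ → Set
Assignment n = Fin n → Fin n

σ₀ : ∀ {n} → Assignment n
σ₀ i = i

Adjacent : ∀ {n} → Fin n → Fin n → Set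
Adjacent i j = toℕ j ≡ suc (toℕ i)

record AllowedSwap {n} (P : Profile n) (σ σ' : Assignment n) : Set where
  field
    i j      : Fin n
    adj      : Adjacent i j
    σ'i      : σ' i ≡ σ j
    σ'j      : σ' j ≡ σ i
    others   : ∀ k → ¬ (k ≡ i) → ¬ (k ≡ j) → σ' k ≡ σ k
    i-better : _≻[_]_ P (σ j) i (σ i)
    j-better : _≻[_]_ P (σ i) j (σ j)

data Reachable {n} (P : Profile n) : Assignment n → Set where
  start : Reachable P σ₀
  step  : ∀ {σ σ'} → Reachable P σ → AllowedSwap P σ σ' → Reachable P σ'

_∈[_,_] : ∀ {n} → Fin n → Fin n → Fin n → Set
q ∈[ x , y ] = ((toℕ x ⊓ toℕ y) ≤ toℕ q) × (toℕ q ≤ (toℕ x ⊔ toℕ y))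

module Submission where

-- Every swap strictly improves both agents involved, so an agent's holding only gets better over
-- time. Consequently an object never reverses direction (the agent it just left would have to take
-- back something worse), every agent an object has passed now strictly prefers its holding to it,
-- and two objects travelling the same way never overtake each other. So if a < b both move right,
-- an agent q visited by both held b before a, hence prefers a to b; leftward motion is symmetric.
-- These facts form an invariant of assignments that every allowed swap preserves.

open import Defs
open import Data.Nat using (ℕ; suc; s≤s⁻¹)
import Data.Nat as ℕ
open import Data.Nat.Properties
  using (n<1+n; <⇒≤; <⇒≱; ≰⇒>; ≤-<-trans; <-≤-trans; m≤n⇒m⊓n≡m; m≤n⇒m⊔n≡n; m≥n⇒m⊓n≡n; m≥n⇒m⊔n≡m)
open import Data.Fin using (Fin; toℕ; _<_; _>_; _≤_; _≟_)
open import Data.Fin.Properties using (≤-refl; ≤-trans; <-trans; <-irrefl; <-asym; <-cmp; ≤∧≢⇒<)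
open import Data.Product using (_×_; _,_; ∃)
open import Data.Sum using (_⊎_; inj₁; inj₂)
open import Data.Empty using (⊥-elim)
open import Relation.Nullary using (¬_; yes; no)
open import Relation.Binary.PropositionalEquality using (_≡_; _≢_; refl; sym; subst; ≢-sym)
open import Relation.Binary.Structures using (IsStrictTotalOrder)
open import Relation.Binary.Definitions using (tri<; tri≈; tri>)

-- Passed x p q: the object that started at agent x and is now held by p has been handed on by q,
-- i.e. q lies between x and p, with p excluded.
Passed : ∀ {n} → Fin n → Fin n → Fin n → Set
Passed x p q = (x ≤ q × q < p) ⊎ (p < q × q ≤ x)

¬Passed-current : ∀ {n} {x p : Fin n} → ¬ Passed x p p
¬Passed-current (inj₁ (_ , p<p)) = <-irrefl refl p<p
¬Passed-current (inj₂ (p<p , _)) = <-irrefl refl p<p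

¬Passed-origin : ∀ {n} {x q : Fin n} → ¬ Passed x x q
¬Passed-origin (inj₁ (x≤q , q<x)) = <⇒≱ q<x x≤q
¬Passed-origin (inj₂ (x<q , q≤x)) = <⇒≱ x<q q≤x

module _ {n} {i j : Fin n} (adj : Adjacent i j) where

  i<j : i < j
  i<j = subst (toℕ i ℕ.<_) (sym adj) (n<1+n (toℕ i))

  <j⇒≤i : ∀ {k : Fin n} → k < j → k ≤ i
  <j⇒≤i {k} k<j = s≤s⁻¹ (subst (suc (toℕ k) ℕ.≤_) adj k<j)

  i<⇒j≤ : ∀ {k : Fin n} → i < k → j ≤ k
  i<⇒j≤ {k} i<k = subst (ℕ._≤ toℕ k) (sym adj) i<k

  Passed-stepʳ : ∀ {x q : Fin n} → q ≢ j → Passed x i q → Passed x j q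
  Passed-stepʳ q≢j (inj₁ (x≤q , q<i)) = inj₁ (x≤q , <-trans q<i i<j)
  Passed-stepʳ q≢j (inj₂ (i<q , q≤x)) = inj₂ (≤∧≢⇒< (i<⇒j≤ i<q) (≢-sym q≢j) , q≤x)

  Passed-stepˡ : ∀ {x q : Fin n} → q ≢ i → Passed x j q → Passed x i q
  Passed-stepˡ q≢i (inj₁ (x≤q , q<j)) = inj₁ (x≤q , ≤∧≢⇒< (<j⇒≤i q<j) q≢i)
  Passed-stepˡ q≢i (inj₂ (j<q , q≤x)) = inj₂ (<-trans i<j j<q , q≤x)

  outside-edge : ∀ {k : Fin n} → k ≢ i → k ≢ j → k < i ⊎ j < k
  outside-edge {k} k≢i k≢j with <-cmp k i
  ... | tri< k<i _ _ = inj₁ k<i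
  ... | tri≈ _ k≡i _ = ⊥-elim (k≢i k≡i)
  ... | tri> _ _ i<k = inj₂ (≤∧≢⇒< (i<⇒j≤ i<k) (≢-sym k≢j))

∈[]-ascending : ∀ {n} {x y q : Fin n} → x ≤ y → q ∈[ x , y ] → x ≤ q × q ≤ y
∈[]-ascending {q = q} x≤y (lo , hi) =
  subst (ℕ._≤ toℕ q) (m≤n⇒m⊓n≡m x≤y) lo , subst (toℕ q ℕ.≤_) (m≤n⇒m⊔n≡n x≤y) hi

∈[]-descending : ∀ {n} {x y q : Fin n} → y ≤ x → q ∈[ x , y ] → y ≤ q × q ≤ x
∈[]-descending {q = q} y≤x (lo , hi) =
  subst (ℕ._≤ toℕ q) (m≥n⇒m⊓n≡n y≤x) lo , subst (toℕ q ℕ.≤_) (m≥n⇒m⊔n≡m y≤x) hi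

module _ {n} (P : Profile n) where
  open Profile P using () renaming (_≻[_]_ to _≻⟨_⟩_)

  ≻-trans : ∀ {q x y z} → x ≻⟨ q ⟩ y → y ≻⟨ q ⟩ z → x ≻⟨ q ⟩ z
  ≻-trans {q} = IsStrictTotalOrder.trans (isStrict P q)

  ≻-irrefl : ∀ {q x} → ¬ x ≻⟨ q ⟩ x
  ≻-irrefl {q} = IsStrictTotalOrder.irrefl (isStrict P q) refl

  ≻-asym : ∀ {q x y} → x ≻⟨ q ⟩ y → ¬ y ≻⟨ q ⟩ x
  ≻-asym {q} = IsStrictTotalOrder.asym (isStrict P q)

  record Invariant (σ : Assignment n) : Set where
    field
      passed-worse    : ∀ {p q} → Passed (σ p) p q → σ q ≻⟨ q ⟩ σ p
      passed-improved : ∀ {p q} → Passed (σ p) p q → σ q ≻⟨ q ⟩ q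
      own-or-better   : ∀ q → σ q ≡ q ⊎ σ q ≻⟨ q ⟩ q
      rightward-order : ∀ {p₁ p₂ q} → σ p₁ < σ p₂ → σ p₁ < p₁ → σ p₂ < p₂ →
                        σ p₂ ≤ q → q ≤ p₁ → q ≤ p₂ → σ p₁ ≻⟨ q ⟩ σ p₂
      leftward-order  : ∀ {p₁ p₂ q} → σ p₁ < σ p₂ → p₁ < σ p₁ → p₂ < σ p₂ →
                        p₁ ≤ q → p₂ ≤ q → q ≤ σ p₁ → σ p₂ ≻⟨ q ⟩ σ p₁

  invariant-σ₀ : Invariant σ₀
  invariant-σ₀ = record
    { passed-worse    = λ h → ⊥-elim (¬Passed-origin h)
    ; passed-improved = λ h → ⊥-elim (¬Passed-origin h)
    ; own-or-better   = λ _ → inj₁ refl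
    ; rightward-order = λ _ p₁<p₁ _ _ _ _ → ⊥-elim (<-irrefl refl p₁<p₁)
    ; leftward-order  = λ _ p₁<p₁ _ _ _ _ → ⊥-elim (<-irrefl refl p₁<p₁)
    }

  module SwapStep {σ σ' : Assignment n} (inv : Invariant σ) (s : AllowedSwap P σ σ') where
    open Invariant inv
    open AllowedSwap s

    data View : Fin n → Fin n → Set where
      at-i      : View i (σ j)
      at-j      : View j (σ i)
      elsewhere : ∀ {k} → k ≢ i → k ≢ j → View k (σ k)

    view : ∀ k → View k (σ' k)
    view k with k ≟ i | k ≟ j
    ... | yes refl | _        = subst (View i) (sym σ'i) at-i
    ... | no _     | yes refl = subst (View j) (sym σ'j) at-j
    ... | no k≢i   | no k≢j   = subst (View k) (sym (others k k≢i k≢j)) (elsewhere k≢i k≢j)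

    -- Objects never turn back: the object moving left onto i did not start at or left of i,
    -- as agent i would then have passed it already and could not now prefer it.
    i<σj : i < σ j
    i<σj = ≰⇒> (λ σj≤i → ≻-asym i-better (passed-worse (inj₁ (σj≤i , i<j adj))))

    σi<j : σ i < j
    σi<j = ≰⇒> (λ j≤σi → ≻-asym j-better (passed-worse (inj₂ (i<j adj , j≤σi))))

    i-improves : σ j ≻⟨ i ⟩ i
    i-improves with own-or-better i
    ... | inj₁ σi≡i = subst (σ j ≻⟨ i ⟩_) σi≡i i-better
    ... | inj₂ σi≻i = ≻-trans i-better σi≻i

    j-improves : σ i ≻⟨ j ⟩ j
    j-improves with own-or-better j
    ... | inj₁ σj≡j = subst (σ i ≻⟨ j ⟩_) σj≡j j-better
    ... | inj₂ σj≻j = ≻-trans j-better σj≻j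

    passed-worse' : ∀ {p q} → Passed (σ' p) p q → σ' q ≻⟨ q ⟩ σ' p
    passed-worse' {p} {q} h with σ' p | view p | σ' q | view q
    ... | _ | at-i          | _ | at-i          = ⊥-elim (¬Passed-current h)
    ... | _ | at-j          | _ | at-i          = i-better
    ... | _ | elsewhere _ _ | _ | at-i          = ≻-trans i-better (passed-worse h)
    ... | _ | at-i          | _ | at-j          = j-better
    ... | _ | at-j          | _ | at-j          = ⊥-elim (¬Passed-current h)
    ... | _ | elsewhere _ _ | _ | at-j          = ≻-trans j-better (passed-worse h)
    ... | _ | at-i          | _ | elsewhere _ q≢j = passed-worse (Passed-stepʳ adj q≢j h)
    ... | _ | at-j          | _ | elsewhere q≢i _ = passed-worse (Passed-stepˡ adj q≢i h)
    ... | _ | elsewhere _ _ | _ | elsewhere _ _ = passed-worse h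

    passed-improved' : ∀ {p q} → Passed (σ' p) p q → σ' q ≻⟨ q ⟩ q
    passed-improved' {p} {q} h with σ' p | view p | σ' q | view q
    ... | _ | _             | _ | at-i            = i-improves
    ... | _ | _             | _ | at-j            = j-improves
    ... | _ | at-i          | _ | elsewhere _ q≢j = passed-improved (Passed-stepʳ adj q≢j h)
    ... | _ | at-j          | _ | elsewhere q≢i _ = passed-improved (Passed-stepˡ adj q≢i h)
    ... | _ | elsewhere _ _ | _ | elsewhere _ _   = passed-improved h

    passed⇒not-own : ∀ {p q} → Passed (σ p) p q → σ q ≢ q
    passed⇒not-own {q = q} h σq≡q = ≻-irrefl (subst (σ q ≻⟨ q ⟩_) (sym σq≡q) (passed-improved h))

    own-or-better' : ∀ q → σ' q ≡ q ⊎ σ' q ≻⟨ q ⟩ q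
    own-or-better' q with σ' q | view q
    ... | _ | at-i          = inj₂ i-improves
    ... | _ | at-j          = inj₂ j-improves
    ... | _ | elsewhere _ _ = own-or-better q

    rightward-order-moved₁ : ∀ {p₂ q} → p₂ ≢ j → σ i < σ p₂ → σ p₂ < p₂ →
                             σ p₂ ≤ q → q ≤ j → q ≤ p₂ → σ i ≻⟨ q ⟩ σ p₂
    rightward-order-moved₁ {p₂} {q} p₂≢j a<b b<p₂ b≤q q≤j q≤p₂ with q ≟ j
    ... | yes refl = ≻-trans j-better (passed-worse (inj₁ (b≤q , ≤∧≢⇒< q≤p₂ (≢-sym p₂≢j))))
    ... | no q≢j   = rightward-order a<b σi<i b<p₂ b≤q q≤i q≤p₂
      where
        q≤i : q ≤ i
        q≤i = <j⇒≤i adj (≤∧≢⇒< q≤j q≢j)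
        σi<i : σ i < i
        σi<i = ≤∧≢⇒< (<j⇒≤i adj σi<j) (λ σi≡i → <⇒≱ a<b (≤-trans b≤q (subst (q ≤_) (sym σi≡i) q≤i)))

    rightward-order-moved₂ : ∀ {p₁ q} → p₁ ≢ i → p₁ ≢ j → σ p₁ < σ i → σ p₁ < p₁ →
                             σ i ≤ q → q ≤ p₁ → σ p₁ ≻⟨ q ⟩ σ i
    rightward-order-moved₂ {p₁} {q} p₁≢i p₁≢j a<b a<p₁ b≤q q≤p₁ with outside-edge adj p₁≢i p₁≢j
    ... | inj₁ p₁<i = rightward-order a<b a<p₁ (≤-<-trans b≤q q<i) b≤q q≤p₁ (<⇒≤ q<i)
      where
        q<i : q < i
        q<i = ≤-<-trans q≤p₁ p₁<i
    ... | inj₂ j<p₁ = ⊥-elim (≻-asym (passed-worse a-passed-i)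
                                     (rightward-order a<b a<p₁ σi<i (<⇒≤ σi<i) (<⇒≤ i<p₁) ≤-refl))
      where
        i<p₁ : i < p₁
        i<p₁ = <-trans (i<j adj) j<p₁
        a-passed-i : Passed (σ p₁) p₁ i
        a-passed-i = inj₁ (<j⇒≤i adj (<-trans a<b σi<j) , i<p₁)
        σi<i : σ i < i
        σi<i = ≤∧≢⇒< (<j⇒≤i adj σi<j) (passed⇒not-own a-passed-i)

    rightward-order' : ∀ {p₁ p₂ q} → σ' p₁ < σ' p₂ → σ' p₁ < p₁ → σ' p₂ < p₂ →
                       σ' p₂ ≤ q → q ≤ p₁ → q ≤ p₂ → σ' p₁ ≻⟨ q ⟩ σ' p₂
    rightward-order' {p₁} {p₂} a<b a<p₁ b<p₂ b≤q q≤p₁ q≤p₂ with σ' p₁ | view p₁ | σ' p₂ | view p₂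
    ... | _ | at-i | _ | _    = ⊥-elim (<-asym a<p₁ i<σj)
    ... | _ | _    | _ | at-i = ⊥-elim (<-asym b<p₂ i<σj)
    ... | _ | at-j | _ | at-j = ⊥-elim (<-irrefl refl a<b)
    ... | _ | at-j | _ | elsewhere _ p₂≢j =
      rightward-order-moved₁ p₂≢j a<b b<p₂ b≤q q≤p₁ q≤p₂
    ... | _ | elsewhere p₁≢i p₁≢j | _ | at-j =
      rightward-order-moved₂ p₁≢i p₁≢j a<b a<p₁ b≤q q≤p₁
    ... | _ | elsewhere _ _ | _ | elsewhere _ _ =
      rightward-order a<b a<p₁ b<p₂ b≤q q≤p₁ q≤p₂

    leftward-order-moved₁ : ∀ {p₂ q} → p₂ ≢ i → p₂ ≢ j → σ j < σ p₂ → p₂ < σ p₂ →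
                            p₂ ≤ q → q ≤ σ j → σ p₂ ≻⟨ q ⟩ σ j
    leftward-order-moved₁ {p₂} {q} p₂≢i p₂≢j a<b p₂<b p₂≤q q≤a with outside-edge adj p₂≢i p₂≢j
    ... | inj₂ j<p₂ = leftward-order a<b (<-≤-trans j<q q≤a) p₂<b (<⇒≤ j<q) p₂≤q q≤a
      where
        j<q : j < q
        j<q = <-≤-trans j<p₂ p₂≤q
    ... | inj₁ p₂<i = ⊥-elim (≻-asym (passed-worse b-passed-j)
                                     (leftward-order a<b j<σj p₂<b ≤-refl (<⇒≤ p₂<j) (<⇒≤ j<σj)))
      where
        p₂<j : p₂ < j
        p₂<j = <-trans p₂<i (i<j adj)
        b-passed-j : Passed (σ p₂) p₂ j
        b-passed-j = inj₂ (p₂<j , i<⇒j≤ adj (<-trans i<σj a<b))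
        j<σj : j < σ j
        j<σj = ≤∧≢⇒< (i<⇒j≤ adj i<σj) (≢-sym (passed⇒not-own b-passed-j))

    leftward-order-moved₂ : ∀ {p₁ q} → p₁ ≢ i → σ p₁ < σ j → p₁ < σ p₁ →
                            p₁ ≤ q → i ≤ q → q ≤ σ p₁ → σ j ≻⟨ q ⟩ σ p₁
    leftward-order-moved₂ {p₁} {q} p₁≢i a<b p₁<a p₁≤q i≤q q≤a with q ≟ i
    ... | yes refl = ≻-trans i-better (passed-worse (inj₂ (≤∧≢⇒< p₁≤q p₁≢i , q≤a)))
    ... | no q≢i   = leftward-order a<b p₁<a j<σj p₁≤q j≤q q≤a
      where
        j≤q : j ≤ q
        j≤q = i<⇒j≤ adj (≤∧≢⇒< i≤q (≢-sym q≢i))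
        j<σj : j < σ j
        j<σj = ≤∧≢⇒< (i<⇒j≤ adj i<σj) (λ j≡σj → <⇒≱ a<b (≤-trans (subst (_≤ q) j≡σj j≤q) q≤a))

    leftward-order' : ∀ {p₁ p₂ q} → σ' p₁ < σ' p₂ → p₁ < σ' p₁ → p₂ < σ' p₂ →
                      p₁ ≤ q → p₂ ≤ q → q ≤ σ' p₁ → σ' p₂ ≻⟨ q ⟩ σ' p₁
    leftward-order' {p₁} {p₂} a<b p₁<a p₂<b p₁≤q p₂≤q q≤a with σ' p₁ | view p₁ | σ' p₂ | view p₂
    ... | _ | at-j | _ | _    = ⊥-elim (<-asym p₁<a σi<j)
    ... | _ | _    | _ | at-j = ⊥-elim (<-asym p₂<b σi<j)
    ... | _ | at-i | _ | at-i = ⊥-elim (<-irrefl refl a<b)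
    ... | _ | at-i | _ | elsewhere p₂≢i p₂≢j =
      leftward-order-moved₁ p₂≢i p₂≢j a<b p₂<b p₂≤q q≤a
    ... | _ | elsewhere p₁≢i _ | _ | at-i =
      leftward-order-moved₂ p₁≢i a<b p₁<a p₁≤q p₂≤q q≤a
    ... | _ | elsewhere _ _ | _ | elsewhere _ _ =
      leftward-order a<b p₁<a p₂<b p₁≤q p₂≤q q≤a

    invariant' : Invariant σ'
    invariant' = record
      { passed-worse    = passed-worse'
      ; passed-improved = passed-improved'
      ; own-or-better   = own-or-better'
      ; rightward-order = rightward-order'
      ; leftward-order  = leftward-order'
      }

  reachable⇒invariant : ∀ {σ} → Reachable P σ → Invariant σ
  reachable⇒invariant start      = invariant-σ₀
  reachable⇒invariant (step r s) = SwapStep.invariant' (reachable⇒invariant r) s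

lemma7 : {n : ℕ} (P : Profile n) (σ : Assignment n) → Reachable P σ →
    (a b a′ b′ : Fin n) → a < b →
    σ a′ ≡ a → σ b′ ≡ b →
    ∃ (λ q → q ∈[ a , a′ ] × q ∈[ b , b′ ]) →
    ((a′ > a → b′ > b → ∀ q → q ∈[ a , a′ ] → q ∈[ b , b′ ] → _≻[_]_ P a q b)
    × (a′ < a → b′ < b → ∀ q → q ∈[ a , a′ ] → q ∈[ b , b′ ] → _≻[_]_ P b q a))
lemma7 P σ r .(σ a′) .(σ b′) a′ b′ a<b refl refl _ = moving-right , moving-left
  where
    open Invariant (reachable⇒invariant P r)

    moving-right : a′ > σ a′ → b′ > σ b′ → ∀ q → q ∈[ σ a′ , a′ ] → q ∈[ σ b′ , b′ ] →
                   _≻[_]_ P (σ a′) q (σ b′)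
    moving-right a<a′ b<b′ q q∈Ia q∈Ib =
      let _ , q≤a′ = ∈[]-ascending (<⇒≤ a<a′) q∈Ia
          b≤q , q≤b′ = ∈[]-ascending (<⇒≤ b<b′) q∈Ib
      in rightward-order a<b a<a′ b<b′ b≤q q≤a′ q≤b′

    moving-left : a′ < σ a′ → b′ < σ b′ → ∀ q → q ∈[ σ a′ , a′ ] → q ∈[ σ b′ , b′ ] →
                  _≻[_]_ P (σ b′) q (σ a′)
    moving-left a′<a b′<b q q∈Ia q∈Ib =
      let a′≤q , q≤a = ∈[]-descending (<⇒≤ a′<a) q∈Ia
          b′≤q , _ = ∈[]-descending (<⇒≤ b′<b) q∈Ib
      in leftward-order a<b a′<a b′<b a′≤q b′≤q q≤a
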